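{- Let $p\geq 5$ be an odd prime with $p \equiv 3 \pmod{4}$ and $r = (p-1)/2$. Exactly one of the following holds: (A) $-1 \notin \langle 2 \rangle$ in $(\mathbb{Z}/r\mathbb{Z})^{\times}$: then $2p$ lies in no $S_k$, $k\ge 0$. (B) $-1 \in \langle 2 \rangle$ and the least positive $t_0$ with $2^{t_0}\equiv -1 \pmod r$ is odd: then $2p$ lies in infinitely many $S_k$, but is never flanked by $14$ at distance $1$. (C) $-1 \in \langle 2 \rangle$ and the least positive $t_0$ with $2^{t_0}\equiv -1 \pmod r$ is even: then $2p$ lies in infinitely many $S_k$ and is flanked by $14$ at distance $1$ at every occurrence (i.e., for every $k$ with $2p\in S_k$ we have $k\ge 1$, $14\in S_{k-1}$ and $14\in S_{k+1}$). In the case that $r$ is prime, case (C) occurs if and only if $4 \mid \operatorname{ord}_r(2)$.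
   Context: For integers $k\ge 0$ and $n\ge 1$, $\sigma_k(n)=\sum_{d\mid n} d^k$ and $\phi(n)$ is Euler's totient function. For each $k\geq 0$, $S_k$ denotes the set of composite positive integers $n$ satisfying $n\cdot\sigma_k(n)\equiv 2 \pmod{\phi(n)}$. For $k\ge 1$, $14$ flanks $n$ at distance $1$ at $k$ if $n\in S_k$, $14\in S_{k-1}$ and $14\in S_{k+1}$. $\operatorname{ord}_r(2)$ is the multiplicative order of $2$ modulo $r$, and $\langle 2\rangle$ is the subgroup of $(\mathbb{Z}/r\mathbb{Z})^\times$ generated by $2$. -}

module Defs where

open import Data.Nat using (ℕ; zero; suc; _+_; _*_; _∸_; _^_; _≤_; _<_)
open import Data.Nat.GCD using (gcd)
open import Data.Nat.Divisibility using (_∣?_)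
open import Data.Nat.Primality using (Composite) public
open import Data.Nat.ListAction using (sum)
open import Data.List using (List; map; upTo; filter; length)
open import Data.Integer using (ℤ; +_; -_) renaming (_-_ to _-ℤ_)
import Data.Integer.Divisibility as ℤDiv
open import Data.Product using (_×_; Σ; ∃)
open import Relation.Nullary using (¬_; Dec; yes; no)
open import Relation.Binary.PropositionalEquality using (_≡_)
open import Data.Nat using (_≟_)

range1 : ℕ → List ℕ
range1 n = map suc (upTo n)

σ : ℕ → ℕ → ℕ
σ k n = sum (map (λ d → d ^ k) (filter (λ d → d ∣? n) (range1 n)))

φ : ℕ → ℕ
φ n = length (filter (λ m → gcd m n ≟ 1) (range1 n))

infix 4 _≡ℤ_[mod_]
_≡ℤ_[mod_] : ℤ → ℤ → ℕ → Set
a ≡ℤ b [mod m ] = (+ m) ℤDiv.∣ (a -ℤ b)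

S : ℕ → ℕ → Set
S k n = Composite n × (+ (n * σ k n) ≡ℤ + 2 [mod φ n ])

Flanks14 : ℕ → ℕ → Set
Flanks14 n k = 1 ≤ k × S k n × S (k ∸ 1) 14 × S (suc k) 14

InfinitelyManyS : ℕ → Set
InfinitelyManyS n = ∀ N → Σ ℕ (λ k → N ≤ k × S k n)

MinusOneIn⟨2⟩ : ℕ → Set
MinusOneIn⟨2⟩ r = Σ ℕ (λ t → + (2 ^ t) ≡ℤ - (+ 1) [mod r ])

LeastPosMinusOneExp : ℕ → ℕ → Set
LeastPosMinusOneExp r t0 =
  0 < t0 × (+ (2 ^ t0) ≡ℤ - (+ 1) [mod r ]) ×
  (∀ t → 0 < t → t < t0 → ¬ (+ (2 ^ t) ≡ℤ - (+ 1) [mod r ]))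

IsOrd2 : ℕ → ℕ → Set
IsOrd2 r o =
  0 < o × (+ (2 ^ o) ≡ℤ + 1 [mod r ]) ×
  (∀ t → 0 < t → t < o → ¬ (+ (2 ^ t) ≡ℤ + 1 [mod r ]))

{-# OPTIONS --safe #-}
module Submission where

-- The divisors of 2p are 1, 2, p, 2p and φ(2p) = 2r, so 2p ∈ S_k says
-- p σ_k(2p) ≡ 1 (mod r); since p ≡ 1 (mod r) the left side is 2 + 2^(k+1), hence
-- 2p ∈ S_k ⟺ 2^(k+1) ≡ -1 (mod r). If t₀ is the least positive t with 2^t ≡ -1, then
-- ord_r(2) = 2t₀ and the solutions are exactly t₀ + 2t₀q, all of the parity of t₀.
-- 14 = 2·7 is the case r = 3, t₀ = 1, so 14 ∈ S_k ⟺ k is even, and whether 14 flanks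
-- 2p ∈ S_k is decided by the parity of k + 1, i.e. of t₀. For r prime, 2^(ord/2) is a
-- square root of 1 other than 1, hence -1, so 4 ∣ ord_r(2) ⟺ t₀ is even.

open import Defs
open import Data.Empty using (⊥-elim)
open import Data.Fin using (toℕ; fromℕ<)
open import Data.Fin.Properties using (pigeonhole; toℕ-fromℕ<)
open import Data.Integer as ℤ using (ℤ; +_; -_; _-_)
import Data.Integer.Divisibility.Signed as ℤ∣
import Data.Integer.Properties as ℤ
open import Data.Integer.Tactic.RingSolver using (solve-∀)
open import Data.List using (List; []; _∷_; filter; length; applyUpTo; map)
open import Data.List.Properties using (map-applyUpTo; filter-accept; filter-reject)
open import Data.Nat as ℕ
  using (ℕ; zero; suc; _+_; _*_; _∸_; _^_; _≤_; _<_; z≤n; s≤s; z<s; _/_; _%_; NonZero; _<?_;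
         nonTrivial⇒n>1; nonTrivial⇒≢1)
open import Data.Nat.Coprimality using (Coprime; coprime-divisor; coprime⇒gcd≡1; gcd≡1⇒coprime)
open import Data.Nat.Divisibility as ℕ∣ using (_∣_; _∣?_; divides; divides-refl)
import Data.Nat.DivMod as ℕ
open import Data.Nat.GCD using (gcd)
open import Data.Nat.Induction using (<-rec)
open import Data.Nat.ListAction using (sum)
open import Data.Nat.Primality
  using (Prime; prime?; composite-≢; euclidsLemma; irreducible[2];
         prime⇒irreducible; prime⇒nonTrivial; prime⇒nonZero)
import Data.Nat.Properties as ℕ
open import Data.Nat.Properties using (<-cmp; anyUpTo?)
open import Data.Nat.Tactic.RingSolver using () renaming (solve-∀ to ℕ-solve-∀)
open import Data.Product using (Σ; ∃; _×_; _,_; proj₁; proj₂)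
import Data.Sum as Sum
open import Data.Sum using (_⊎_; inj₁; inj₂; [_,_]′)
open import Function.Base using (_∘_; id)
open import Function.Bundles using (_⇔_; mk⇔; Equivalence)
open import Function.Construct.Composition using (_⇔-∘_)
open import Function.Construct.Symmetry using (⇔-sym)
open import Relation.Binary using (Setoid; IsEquivalence; tri<; tri≈; tri>)
open import Relation.Binary.Definitions using () renaming (Decidable to Decidable₂)
open import Relation.Binary.PropositionalEquality
  using (_≡_; _≢_; refl; sym; trans; cong; cong₂; subst; subst₂; module ≡-Reasoning)
import Relation.Binary.Reasoning.Setoid as SetoidReasoning
open import Relation.Nullary using (¬_; yes; no; contradiction)
open import Relation.Nullary.Decidable using (map′; _×-dec_; toWitness)
open import Relation.Unary using (Decidable)

open Equivalence using (to; from)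

LeastPositive : (ℕ → Set) → ℕ → Set
LeastPositive P n = 0 < n × P n × (∀ t → 0 < t → t < n → ¬ P t)

module _ {P : ℕ → Set} where

  LeastPositive-unique : ∀ {m n} → LeastPositive P m → LeastPositive P n → m ≡ n
  LeastPositive-unique {m} {n} (0<m , Pm , m-least) (0<n , Pn , n-least) with <-cmp m n
  ... | tri< m<n _ _ = ⊥-elim (n-least m 0<m m<n Pm)
  ... | tri≈ _ m≡n _ = m≡n
  ... | tri> _ _ n<m = ⊥-elim (m-least n 0<n n<m Pn)

  LeastPositive-map : ∀ {Q : ℕ → Set} {n} → (∀ {t} → P t ⇔ Q t) → LeastPositive P n → LeastPositive Q n
  LeastPositive-map P⇔Q (0<n , Pn , least) =
    0<n , to P⇔Q Pn , λ t 0<t t<n Qt → least t 0<t t<n (from P⇔Q Qt)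

  leastPositive : Decidable P → ∀ {n} → 0 < n → P n → ∃ (LeastPositive P)
  leastPositive P? {n} = <-rec (λ n → 0 < n → P n → ∃ (LeastPositive P)) search n
    where
    search : ∀ n → (∀ {m} → m < n → 0 < m → P m → ∃ (LeastPositive P)) →
             0 < n → P n → ∃ (LeastPositive P)
    search n below 0<n Pn with anyUpTo? (λ t → 0 <? t ×-dec P? t) n
    ... | yes (m , m<n , 0<m , Pm) = below m<n 0<m Pm
    ... | no none = n , 0<n , Pn , λ t 0<t t<n Pt → none (t , t<n , 0<t , Pt)

n%2≡0⊎n%2≡1 : ∀ n → n % 2 ≡ 0 ⊎ n % 2 ≡ 1
n%2≡0⊎n%2≡1 0             = inj₁ refl
n%2≡0⊎n%2≡1 1             = inj₂ refl
n%2≡0⊎n%2≡1 (suc (suc n)) = n%2≡0⊎n%2≡1 n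

suc[n]%2≡1⇔n%2≡0 : ∀ n → suc n % 2 ≡ 1 ⇔ n % 2 ≡ 0
suc[n]%2≡1⇔n%2≡0 0             = mk⇔ (λ _ → refl) (λ _ → refl)
suc[n]%2≡1⇔n%2≡0 1             = mk⇔ (λ ()) (λ ())
suc[n]%2≡1⇔n%2≡0 (suc (suc n)) = suc[n]%2≡1⇔n%2≡0 n

2∤1+2*n : ∀ n → ¬ 2 ∣ 1 + 2 * n
2∤1+2*n n 2∣1+2n =
  contradiction (ℕ∣.∣1⇒≡1 (ℕ∣.∣m+n∣m⇒∣n (subst (2 ∣_) (ℕ.+-comm 1 (2 * n)) 2∣1+2n) (ℕ∣.m∣m*n n))) λ ()

¬2∣⇒Coprime[n,2] : ∀ {n} → ¬ 2 ∣ n → Coprime n 2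
¬2∣⇒Coprime[n,2] 2∤n (d∣n , d∣2) with irreducible[2] d∣2
... | inj₁ d≡1 = d≡1
... | inj₂ refl = ⊥-elim (2∤n d∣n)

∤-between : ∀ {n m} → n < m → m < 2 * n → ¬ n ∣ m
∤-between n<m m<2n (divides-refl zero)                = ℕ.<-irrefl refl (ℕ.<-≤-trans n<m z≤n)
∤-between {n} n<m m<2n (divides-refl 1)             = ℕ.<-irrefl (sym (ℕ.+-identityʳ n)) n<m
∤-between {n} n<m m<2n (divides-refl (suc (suc q))) =
  ℕ.<-irrefl refl (ℕ.<-≤-trans m<2n (ℕ.+-monoʳ-≤ n (ℕ.+-monoʳ-≤ n z≤n)))

odd-prime⇒3≤ : ∀ {p r} → Prime p → p ≡ 1 + 2 * r → 3 ≤ p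
odd-prime⇒3≤ {r = zero}  p-prime refl =
  ⊥-elim (ℕ.<-irrefl refl (nonTrivial⇒n>1 1 {{prime⇒nonTrivial p-prime}}))
odd-prime⇒3≤ {r = suc r} _       refl = s≤s (ℕ.*-monoʳ-≤ 2 (s≤s z≤n))

prime-∤⇒Coprime : ∀ {p n} → Prime p → ¬ p ∣ n → Coprime n p
prime-∤⇒Coprime p-prime p∤n (d∣n , d∣p) with prime⇒irreducible p-prime d∣p
... | inj₁ d≡1 = d≡1
... | inj₂ refl = ⊥-elim (p∤n d∣n)

∣2*p⇒ : ∀ {p d} → Prime p → d ∣ 2 * p → d ≡ 1 ⊎ d ≡ 2 ⊎ d ≡ p ⊎ d ≡ 2 * p
∣2*p⇒ {p} {d} p-prime d∣2p with p ∣? d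
... | no p∤d = [ inj₁ , inj₂ ∘ inj₁ ]′ (irreducible[2] (coprime-divisor d⊥p d∣p*2))
  where
  d⊥p = prime-∤⇒Coprime p-prime p∤d
  d∣p*2 = subst (d ∣_) (ℕ.*-comm 2 p) d∣2p
... | yes (divides-refl q)
  with irreducible[2] (ℕ∣.*-cancelˡ-∣ p {{prime⇒nonZero p-prime}}
                         (subst₂ _∣_ (ℕ.*-comm q p) (ℕ.*-comm 2 p) d∣2p))
...   | inj₁ refl = inj₂ (inj₂ (inj₁ (ℕ.*-identityˡ p)))
...   | inj₂ refl = inj₂ (inj₂ (inj₂ refl))

Coprime[n,2*p]⇔ : ∀ {p n} → Prime p → Coprime n (2 * p) ⇔ (¬ 2 ∣ n × ¬ p ∣ n)
Coprime[n,2*p]⇔ {p} {n} p-prime = mk⇔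
  (λ n⊥2p → (λ 2∣n → contradiction (n⊥2p (2∣n , ℕ∣.m∣m*n p)) λ ())
          , (λ p∣n → nonTrivial⇒≢1 {{prime⇒nonTrivial p-prime}} (n⊥2p (p∣n , ℕ∣.n∣m*n 2))))
  coprime
  where
  coprime : ¬ 2 ∣ n × ¬ p ∣ n → Coprime n (2 * p)
  coprime (2∤n , p∤n) (d∣n , d∣2p) with ∣2*p⇒ p-prime d∣2p
  ... | inj₁ d≡1                = d≡1
  ... | inj₂ (inj₁ refl)        = ⊥-elim (2∤n d∣n)
  ... | inj₂ (inj₂ (inj₁ refl)) = ⊥-elim (p∤n d∣n)
  ... | inj₂ (inj₂ (inj₂ refl)) = ⊥-elim (p∤n (ℕ∣.∣-trans (ℕ∣.n∣m*n 2) d∣n))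

composite[2*p] : ∀ {p} → Prime p → Composite (2 * p)
composite[2*p] {p} p-prime =
  composite-≢ 2 (ℕ.<⇒≢ (ℕ.*-monoʳ-< 2 (nonTrivial⇒n>1 p {{prime⇒nonTrivial p-prime}}))) (ℕ∣.m∣m*n p)
  where instance _ = ℕ.m*n≢0 2 p {{_}} {{prime⇒nonZero p-prime}}

module Congruence (m : ℕ) where

  -- A record rather than a synonym for + m ∣ a - b, so that a and b can be found by unification.
  infix 4 _≈_ _≈?_
  record _≈_ (a b : ℤ) : Set where
    constructor ∣⇒≈
    field ≈⇒∣ : + m ℤ∣.∣ a - b
  open _≈_ public

  ≡ℤ⇔≈ : ∀ {a b} → a ≡ℤ b [mod m ] ⇔ a ≈ b
  ≡ℤ⇔≈ = mk⇔ (∣⇒≈ ∘ ℤ∣.∣ᵤ⇒∣) (ℤ∣.∣⇒∣ᵤ ∘ ≈⇒∣)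

  _≈?_ : Decidable₂ _≈_
  a ≈? b = map′ ∣⇒≈ ≈⇒∣ (+ m ℤ∣.∣? a - b)

  ≡⇒≈ : ∀ {a b} → a ≡ b → a ≈ b
  ≡⇒≈ {a} refl = ∣⇒≈ (ℤ∣.divides (+ 0) (ℤ.+-inverseʳ a))

  ≈-refl : ∀ {a} → a ≈ a
  ≈-refl = ≡⇒≈ refl

  ≈-sym : ∀ {a b} → a ≈ b → b ≈ a
  ≈-sym {a} {b} (∣⇒≈ m∣a-b) = ∣⇒≈ (subst (+ m ℤ∣.∣_) (negate a b) (ℤ∣.∣m⇒∣-m m∣a-b))
    where negate : ∀ a b → - (a - b) ≡ b - a
          negate = solve-∀

  ≈-trans : ∀ {a b c} → a ≈ b → b ≈ c → a ≈ c
  ≈-trans {a} {b} {c} (∣⇒≈ m∣a-b) (∣⇒≈ m∣b-c) =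
    ∣⇒≈ (subst (+ m ℤ∣.∣_) (telescope a b c) (ℤ∣.∣m∣n⇒∣m+n m∣a-b m∣b-c))
    where telescope : ∀ a b c → (a - b) ℤ.+ (b - c) ≡ a - c
          telescope = solve-∀

  ≈-isEquivalence : IsEquivalence _≈_
  ≈-isEquivalence = record { refl = ≈-refl ; sym = ≈-sym ; trans = ≈-trans }

  ≈-setoid : Setoid _ _
  ≈-setoid = record { isEquivalence = ≈-isEquivalence }

  +-cong : ∀ {a b c d} → a ≈ b → c ≈ d → a ℤ.+ c ≈ b ℤ.+ d
  +-cong {a} {b} {c} {d} (∣⇒≈ m∣a-b) (∣⇒≈ m∣c-d) =
    ∣⇒≈ (subst (+ m ℤ∣.∣_) (regroup a b c d) (ℤ∣.∣m∣n⇒∣m+n m∣a-b m∣c-d))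
    where regroup : ∀ a b c d → (a - b) ℤ.+ (c - d) ≡ (a ℤ.+ c) - (b ℤ.+ d)
          regroup = solve-∀

  *-cong : ∀ {a b c d} → a ≈ b → c ≈ d → a ℤ.* c ≈ b ℤ.* d
  *-cong {a} {b} {c} {d} (∣⇒≈ m∣a-b) (∣⇒≈ m∣c-d) =
    ∣⇒≈ (subst (+ m ℤ∣.∣_) (regroup a b c d) (ℤ∣.∣m∣n⇒∣m+n (ℤ∣.∣m⇒∣m*n c m∣a-b) (ℤ∣.∣n⇒∣m*n b m∣c-d)))
    where regroup : ∀ a b c d → (a - b) ℤ.* c ℤ.+ b ℤ.* (c - d) ≡ a ℤ.* c - b ℤ.* d
          regroup = solve-∀

  *-congˡ : ∀ c {a b} → a ≈ b → c ℤ.* a ≈ c ℤ.* b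
  *-congˡ c = *-cong (≈-refl {c})

  +-cancelˡ : ∀ a {b c} → a ℤ.+ b ≈ a ℤ.+ c → b ≈ c
  +-cancelˡ a {b} {c} (∣⇒≈ m∣a+b-a+c) = ∣⇒≈ (subst (+ m ℤ∣.∣_) (cancel a b c) m∣a+b-a+c)
    where cancel : ∀ a b c → (a ℤ.+ b) - (a ℤ.+ c) ≡ b - c
          cancel = solve-∀

  pos-+-cong : ∀ {a b c d} → + a ≈ + b → + c ≈ + d → + (a + c) ≈ + (b + d)
  pos-+-cong {a} {b} {c} {d} a≈b c≈d =
    subst₂ _≈_ (sym (ℤ.pos-+ a c)) (sym (ℤ.pos-+ b d)) (+-cong a≈b c≈d)

  pos-*-cong : ∀ {a b c d} → + a ≈ + b → + c ≈ + d → + (a * c) ≈ + (b * d)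
  pos-*-cong {a} {b} {c} {d} a≈b c≈d =
    subst₂ _≈_ (sym (ℤ.pos-* a c)) (sym (ℤ.pos-* b d)) (*-cong a≈b c≈d)

  ^-cong : ∀ {a b} k → + a ≈ + b → + (a ^ k) ≈ + (b ^ k)
  ^-cong zero    a≈b = ≈-refl
  ^-cong (suc k) a≈b = pos-*-cong a≈b (^-cong k a≈b)

  a+k*m≈a : ∀ a k → + (a + k * m) ≈ + a
  a+k*m≈a a k = ∣⇒≈ (subst (+ m ℤ∣.∣_) (sym difference) (ℤ∣.divides (+ k) (ℤ.pos-* k m)))
    where
    cancel : ∀ a b → (a ℤ.+ b) - a ≡ b
    cancel = solve-∀
    difference : + (a + k * m) - + a ≡ + (k * m)
    difference = trans (cong (_- + a) (ℤ.pos-+ a (k * m))) (cancel (+ a) (+ (k * m)))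

  n≈n%m : .{{_ : NonZero m}} → ∀ n → + n ≈ + (n % m)
  n≈n%m n = subst (λ x → + x ≈ + (n % m)) (sym (ℕ.m≡m%n+[m/n]*n n m)) (a+k*m≈a (n % m) (n / m))

  %-≡⇒≈ : .{{_ : NonZero m}} → ∀ {a b} → a % m ≡ b % m → + a ≈ + b
  %-≡⇒≈ {a} {b} a%m≡b%m = ≈-trans (n≈n%m a) (≈-trans (≡⇒≈ (cong +_ a%m≡b%m)) (≈-sym (n≈n%m b)))

  *-cancelˡ : ∀ {c} → Coprime m c → ∀ a b → + c ℤ.* a ≈ + c ℤ.* b → a ≈ b
  *-cancelˡ {c} m⊥c a b (∣⇒≈ m∣ca-cb) = ∣⇒≈ (ℤ∣.∣ᵤ⇒∣ (coprime-divisor m⊥c m∣c[a-b]))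
    where
    factor : ∀ c a b → c ℤ.* a - c ℤ.* b ≡ c ℤ.* (a - b)
    factor = solve-∀
    m∣c[a-b] : m ∣ c * ℤ.∣ a - b ∣
    m∣c[a-b] = subst (m ∣_) (ℤ.abs-* (+ c) (a - b)) (ℤ∣.∣⇒∣ᵤ (subst (+ m ℤ∣.∣_) (factor (+ c) a b) m∣ca-cb))

  2^*-cancelˡ : Coprime m 2 → ∀ k a b → + (2 ^ k) ℤ.* a ≈ + (2 ^ k) ℤ.* b → a ≈ b
  2^*-cancelˡ m⊥2 zero    a b = subst₂ _≈_ (ℤ.*-identityˡ a) (ℤ.*-identityˡ b)
  2^*-cancelˡ m⊥2 (suc k) a b =
    2^*-cancelˡ m⊥2 k a b ∘ *-cancelˡ m⊥2 _ _ ∘ subst₂ _≈_ (reassoc a) (reassoc b)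
    where reassoc : ∀ x → + (2 ^ suc k) ℤ.* x ≡ + 2 ℤ.* (+ (2 ^ k) ℤ.* x)
          reassoc x = trans (cong (ℤ._* x) (ℤ.pos-* 2 (2 ^ k))) (ℤ.*-assoc (+ 2) (+ (2 ^ k)) x)

  x²≈1⇒x≈±1 : Prime m → ∀ {x} → x ℤ.* x ≈ + 1 → x ≈ + 1 ⊎ x ≈ - + 1
  x²≈1⇒x≈±1 m-prime {x} (∣⇒≈ m∣x²-1) =
    Sum.map (∣⇒≈ ∘ ℤ∣.∣ᵤ⇒∣) (∣⇒≈ ∘ subst (+ m ℤ∣.∣_) (plus x) ∘ ℤ∣.∣ᵤ⇒∣)
            (euclidsLemma _ _ m-prime m∣[x-1][x+1])
    where
    factor : ∀ x → x ℤ.* x - + 1 ≡ (x - + 1) ℤ.* (x ℤ.+ + 1)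
    factor = solve-∀
    plus : ∀ x → x ℤ.+ + 1 ≡ x - - + 1
    plus = solve-∀
    m∣[x-1][x+1] : m ∣ ℤ.∣ x - + 1 ∣ * ℤ.∣ x ℤ.+ + 1 ∣
    m∣[x-1][x+1] = subst (m ∣_) (ℤ.abs-* (x - + 1) (x ℤ.+ + 1))
                         (ℤ∣.∣⇒∣ᵤ (subst (+ m ℤ∣.∣_) (factor x) m∣x²-1))

mod-*-cancelˡ⇔ : ∀ c {m a b} .{{_ : NonZero c}} →
  + c ℤ.* a ≡ℤ + c ℤ.* b [mod c * m ] ⇔ a ≡ℤ b [mod m ]
mod-*-cancelˡ⇔ c {m} {a} {b} =
  mk⇔ (ℕ∣.*-cancelˡ-∣ c ∘ subst (c * m ∣_) scaled)
      (subst (c * m ∣_) (sym scaled) ∘ ℕ∣.*-monoʳ-∣ c)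
  where
  factor : ∀ c a b → c ℤ.* a - c ℤ.* b ≡ c ℤ.* (a - b)
  factor = solve-∀
  scaled : ℤ.∣ + c ℤ.* a - + c ℤ.* b ∣ ≡ c * ℤ.∣ a - b ∣
  scaled = trans (cong ℤ.∣_∣ (factor (+ c) a b)) (ℤ.abs-* (+ c) (a - b))

module PowersOfTwo (r : ℕ) where

  open Congruence r public

  MinusOne One : ℕ → Set
  MinusOne t = + (2 ^ t) ≈ - + 1
  One t = + (2 ^ t) ≈ + 1

  MinusOne? : Decidable MinusOne
  MinusOne? t = + (2 ^ t) ≈? - + 1

  One? : Decidable One
  One? t = + (2 ^ t) ≈? + 1

  LeastPosMinusOneExp⇔ : ∀ {t} → LeastPosMinusOneExp r t ⇔ LeastPositive MinusOne t
  LeastPosMinusOneExp⇔ = mk⇔ (LeastPositive-map ≡ℤ⇔≈) (LeastPositive-map (⇔-sym ≡ℤ⇔≈))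

  IsOrd2⇔ : ∀ {o} → IsOrd2 r o ⇔ LeastPositive One o
  IsOrd2⇔ = mk⇔ (LeastPositive-map ≡ℤ⇔≈) (LeastPositive-map (⇔-sym ≡ℤ⇔≈))

  -- Exponents are explicit arguments: the unifier cannot recover t from 2 ^ t.
  2^-homo : ∀ a b {u v} → + (2 ^ a) ≈ u → + (2 ^ b) ≈ v → + (2 ^ (a + b)) ≈ u ℤ.* v
  2^-homo a b 2^a≈u 2^b≈v = ≈-trans
    (≡⇒≈ (trans (cong +_ (ℕ.^-distribˡ-+-* 2 a b)) (ℤ.pos-* (2 ^ a) (2 ^ b))))
    (*-cong 2^a≈u 2^b≈v)

  -- u is ±1, so dividing by u is multiplying by u.
  2^-cancelˡ : ∀ a c {u w} → u ℤ.* u ≡ + 1 → + (2 ^ a) ≈ u → + (2 ^ (a + c)) ≈ w → + (2 ^ c) ≈ u ℤ.* w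
  2^-cancelˡ a c {u} {w} u²≡1 2^a≈u 2^[a+c]≈w = begin
    + (2 ^ c)                ≡⟨ unit ⟨
    u ℤ.* (u ℤ.* + (2 ^ c))  ≈⟨ *-congˡ u (2^-homo a c 2^a≈u ≈-refl) ⟨
    u ℤ.* + (2 ^ (a + c))    ≈⟨ *-congˡ u 2^[a+c]≈w ⟩
    u ℤ.* w                  ∎
    where
    open SetoidReasoning ≈-setoid
    unit : u ℤ.* (u ℤ.* + (2 ^ c)) ≡ + (2 ^ c)
    unit = trans (sym (ℤ.*-assoc u u (+ (2 ^ c))))
                 (trans (cong (ℤ._* + (2 ^ c)) u²≡1) (ℤ.*-identityˡ (+ (2 ^ c))))

  MinusOne⇒One[2*] : ∀ t → MinusOne t → One (2 * t)
  MinusOne⇒One[2*] t minus-t =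
    subst One (cong (λ x → t + x) (sym (ℕ.+-identityʳ t))) (2^-homo t t minus-t minus-t)

  One-* : ∀ q o → One o → One (q * o)
  One-* zero    o one-o = ≈-refl
  One-* (suc q) o one-o = 2^-homo o (q * o) one-o (One-* q o one-o)

  MinusOne-periodic : ∀ t₀ → MinusOne t₀ → ∀ q → MinusOne (t₀ + q * (2 * t₀))
  MinusOne-periodic t₀ minus-t₀ q =
    2^-homo t₀ (q * (2 * t₀)) minus-t₀ (One-* q (2 * t₀) (MinusOne⇒One[2*] t₀ minus-t₀))

  2^%≈2^ : ∀ {o} .{{_ : NonZero o}} → One o → ∀ t → + (2 ^ (t % o)) ≈ + (2 ^ t)
  2^%≈2^ {o} one-o t = ≈-sym (begin
    + (2 ^ t)                    ≡⟨ cong (λ k → + (2 ^ k)) (ℕ.m≡m%n+[m/n]*n t o) ⟩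
    + (2 ^ (t % o + t / o * o))  ≈⟨ 2^-homo (t % o) (t / o * o) ≈-refl (One-* (t / o) o one-o) ⟩
    + (2 ^ (t % o)) ℤ.* + 1      ≡⟨ ℤ.*-identityʳ _ ⟩
    + (2 ^ (t % o))              ∎)
    where open SetoidReasoning ≈-setoid

  order-divides : ∀ {o} t → LeastPositive One o → One t → o ∣ t
  order-divides {o} t (0<o , one-o , below) one-t = ℕ∣.m%n≡0⇒n∣m t o remainder≡0
    where
    instance _ = ℕ.>-nonZero 0<o
    remainder≡0 : t % o ≡ 0
    remainder≡0 with t % o in eq
    ... | zero  = refl
    ... | suc k = ⊥-elim (below (suc k) z<s (subst (_< o) eq (ℕ.m%n<n t o))
                                            (subst One eq (≈-trans (2^%≈2^ one-o t) one-t)))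

  2^a≈2^b⇒One[b∸a] : Coprime r 2 → ∀ {a b} → a < b → + (2 ^ a) ≈ + (2 ^ b) → One (b ∸ a)
  2^a≈2^b⇒One[b∸a] r⊥2 {a} {b} a<b 2^a≈2^b = 2^*-cancelˡ r⊥2 a (+ (2 ^ (b ∸ a))) (+ 1) (begin
    + (2 ^ a) ℤ.* + (2 ^ (b ∸ a))  ≈⟨ 2^-homo a (b ∸ a) ≈-refl ≈-refl ⟨
    + (2 ^ (a + (b ∸ a)))          ≡⟨ cong (λ k → + (2 ^ k)) (ℕ.m+[n∸m]≡n (ℕ.<⇒≤ a<b)) ⟩
    + (2 ^ b)                      ≈⟨ 2^a≈2^b ⟨
    + (2 ^ a)                      ≡⟨ ℤ.*-identityʳ (+ (2 ^ a)) ⟨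
    + (2 ^ a) ℤ.* + 1              ∎)
    where open SetoidReasoning ≈-setoid

  -- Pigeonhole on the residues of 2^0, ..., 2^r.
  order-exists : .{{_ : NonZero r}} → Coprime r 2 → ∃ (LeastPositive One)
  order-exists r⊥2 with pigeonhole (ℕ.n<1+n r) (λ i → fromℕ< (ℕ.m%n<n (2 ^ toℕ i) r))
  ... | i , j , i<j , same =
    leastPositive One? (ℕ.m<n⇒0<n∸m i<j) (2^a≈2^b⇒One[b∸a] r⊥2 i<j (%-≡⇒≈ residue-same))
    where
    residue-same : 2 ^ toℕ i % r ≡ 2 ^ toℕ j % r
    residue-same = trans (sym (toℕ-fromℕ< _)) (trans (cong toℕ same) (toℕ-fromℕ< _))

  module _ (3≤r : 3 ≤ r) where

    1≉-1 : ¬ (+ 1 ≈ - + 1)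
    1≉-1 (∣⇒≈ r∣2) = ℕ.<⇒≱ 3≤r (ℕ∣.∣⇒≤ (ℤ∣.∣⇒∣ᵤ r∣2))

    MinusOne⇒0< : ∀ t → MinusOne t → 0 < t
    MinusOne⇒0< zero    = ⊥-elim ∘ 1≉-1
    MinusOne⇒0< (suc t) = λ _ → z<s

    MinusOne-below : ∀ {t₀} → LeastPositive MinusOne t₀ → ∀ t → t < t₀ → ¬ MinusOne t
    MinusOne-below _               zero    _    = 1≉-1
    MinusOne-below (_ , _ , below) (suc t) t<t₀ = below (suc t) z<s t<t₀

    least⇒order : ∀ {t₀} → LeastPositive MinusOne t₀ → LeastPositive One (2 * t₀)
    least⇒order {t₀} (0<t₀ , minus-t₀ , below) =
      ℕ.*-monoʳ-< 2 0<t₀ , MinusOne⇒One[2*] t₀ minus-t₀ , no-smaller-one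
      where
      instance _ = ℕ.>-nonZero 0<t₀
      no-smaller-one : ∀ u → 0 < u → u < 2 * t₀ → ¬ One u
      no-smaller-one u 0<u u<2t₀ one-u with <-cmp u t₀
      ... | tri< u<t₀ _ _ = below (t₀ ∸ u) (ℕ.m<n⇒0<n∸m u<t₀) (ℕ.∸-monoʳ-< 0<u (ℕ.<⇒≤ u<t₀))
              (2^-cancelˡ u (t₀ ∸ u) refl one-u
                 (subst MinusOne (sym (ℕ.m+[n∸m]≡n (ℕ.<⇒≤ u<t₀))) minus-t₀))
      ... | tri≈ _ refl _ = 1≉-1 (≈-trans (≈-sym one-u) minus-t₀)
      ... | tri> _ _ t₀<u = below (u ∸ t₀) (ℕ.m<n⇒0<n∸m t₀<u)
              (ℕ.m<n+o⇒m∸n<o u t₀ (subst (u <_) (cong (λ x → t₀ + x) (ℕ.+-identityʳ t₀)) u<2t₀))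
              (2^-cancelˡ t₀ (u ∸ t₀) refl minus-t₀
                 (subst One (sym (ℕ.m+[n∸m]≡n (ℕ.<⇒≤ t₀<u))) one-u))

    MinusOne-solution : ∀ {t₀} → LeastPositive MinusOne t₀ →
                        ∀ t → MinusOne t → ∃ λ q → t ≡ t₀ + q * (2 * t₀)
    MinusOne-solution {t₀} least@(_ , minus-t₀ , _) t minus-t with t ℕ.<? t₀
    ... | yes t<t₀ = ⊥-elim (MinusOne-below least t t<t₀ minus-t)
    ... | no  t≮t₀ =
      quotient 2t₀∣rest , trans (sym t₀+rest≡t) (cong (λ x → t₀ + x) (equality 2t₀∣rest))
      where
      open _∣_ using (quotient; equality)
      t₀+rest≡t : t₀ + (t ∸ t₀) ≡ t
      t₀+rest≡t = ℕ.m+[n∸m]≡n (ℕ.≮⇒≥ t≮t₀)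
      2t₀∣rest : 2 * t₀ ∣ t ∸ t₀
      2t₀∣rest = order-divides (t ∸ t₀) (least⇒order least)
        (2^-cancelˡ t₀ (t ∸ t₀) refl minus-t₀ (subst MinusOne (sym t₀+rest≡t) minus-t))

    MinusOne-parity : ∀ {t₀} → LeastPositive MinusOne t₀ → ∀ t → MinusOne t → t % 2 ≡ t₀ % 2
    MinusOne-parity {t₀} least t minus-t with MinusOne-solution least t minus-t
    ... | q , t≡t₀+q*2t₀ = begin
      t % 2                    ≡⟨ cong (_% 2) t≡t₀+q*2t₀ ⟩
      (t₀ + q * (2 * t₀)) % 2  ≡⟨ cong (λ x → (t₀ + x) % 2) (regroup q t₀) ⟩
      (t₀ + q * t₀ * 2) % 2    ≡⟨ ℕ.[m+kn]%n≡m%n t₀ (q * t₀) 2 ⟩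
      t₀ % 2                   ∎
      where
      open ≡-Reasoning
      regroup : ∀ q t₀ → q * (2 * t₀) ≡ q * t₀ * 2
      regroup = ℕ-solve-∀

    MinusOne-dec-from-order : ∀ {o} → LeastPositive One o →
                              ∃ (LeastPositive MinusOne) ⊎ (∀ t → ¬ MinusOne t)
    MinusOne-dec-from-order {suc o} (_ , one-o , _) with anyUpTo? MinusOne? (suc o)
    ... | yes (t , _ , minus-t) = inj₁ (leastPositive MinusOne? (MinusOne⇒0< t minus-t) minus-t)
    ... | no  none = inj₂ λ t minus-t →
      none (t % suc o , ℕ.m%n<n t (suc o) , ≈-trans (2^%≈2^ one-o t) minus-t)

    MinusOne-dec : ¬ 2 ∣ r → ∃ (LeastPositive MinusOne) ⊎ (∀ t → ¬ MinusOne t)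
    MinusOne-dec r-odd = MinusOne-dec-from-order
      (proj₂ (order-exists {{ℕ.>-nonZero (ℕ.<-trans z<s 3≤r)}} (¬2∣⇒Coprime[n,2] r-odd)))

    -- For prime r the only square roots of 1 are ±1, so 2^h ≡ -1 at half the order.
    half-order-least : Prime r → ∀ {h} → LeastPositive One (2 * h) → LeastPositive MinusOne h
    half-order-least r-prime {suc h} (_ , one-2h , below) = z<s , minus-h , no-smaller
      where
      square : + (2 ^ suc h) ℤ.* + (2 ^ suc h) ≈ + 1
      square = ≈-trans (≈-sym (2^-homo (suc h) (suc h) ≈-refl ≈-refl))
                       (subst One (cong (λ x → suc h + x) (ℕ.+-identityʳ (suc h))) one-2h)
      minus-h : MinusOne (suc h)
      minus-h = [ (λ one-h → ⊥-elim (below (suc h) z<s (ℕ.m<m+n (suc h) z<s) one-h)) , id ]′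
                  (x²≈1⇒x≈±1 r-prime square)
      no-smaller : ∀ t → 0 < t → t < suc h → ¬ MinusOne t
      no-smaller t 0<t t<h minus-t =
        below (2 * t) (ℕ.*-monoʳ-< 2 0<t) (ℕ.*-monoʳ-< 2 t<h) (MinusOne⇒One[2*] t minus-t)

    least-even⇔order-4∣ : Prime r →
      (∃ λ t₀ → LeastPositive MinusOne t₀ × t₀ % 2 ≡ 0) ⇔ (∃ λ o → LeastPositive One o × 4 ∣ o)
    least-even⇔order-4∣ r-prime = mk⇔ forward backward
      where
      forward : (∃ λ t₀ → LeastPositive MinusOne t₀ × t₀ % 2 ≡ 0) → ∃ λ o → LeastPositive One o × 4 ∣ o
      forward (t₀ , least , even) =
        2 * t₀ , least⇒order least , ℕ∣.*-monoʳ-∣ 2 (ℕ∣.m%n≡0⇒n∣m t₀ 2 even)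
      backward : (∃ λ o → LeastPositive One o × 4 ∣ o) → ∃ λ t₀ → LeastPositive MinusOne t₀ × t₀ % 2 ≡ 0
      backward (o , order , divides w o≡w*4) =
        w * 2 ,
        half-order-least r-prime (subst (LeastPositive One) (trans o≡w*4 (regroup w)) order) ,
        ℕ.m*n%n≡0 w 2
        where
        regroup : ∀ w → w * 4 ≡ 2 * (w * 2)
        regroup = ℕ-solve-∀

-- Divisors and totient of 2p

interval : ℕ → ℕ → List ℕ
interval a zero    = []
interval a (suc n) = a ∷ interval (suc a) n

applyUpTo≡interval : ∀ {f} a n → (∀ i → f i ≡ a + i) → applyUpTo f n ≡ interval a n
applyUpTo≡interval a zero    _     = refl
applyUpTo≡interval a (suc n) f≗a+ = cong₂ _∷_ (trans (f≗a+ 0) (ℕ.+-identityʳ a))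
  (applyUpTo≡interval (suc a) n (λ i → trans (f≗a+ (suc i)) (ℕ.+-suc a i)))

range1≡interval : ∀ n → range1 n ≡ interval 1 n
range1≡interval n = trans (map-applyUpTo id suc n) (applyUpTo≡interval 1 n (λ _ → refl))

module _ {P : ℕ → Set} (P? : Decidable P) where

  filter-interval-skip : ∀ a m {n} → (∀ d → a ≤ d → d < a + m → ¬ P d) →
                         filter P? (interval a (m + n)) ≡ filter P? (interval (a + m) n)
  filter-interval-skip a zero    {n} _  = cong (λ b → filter P? (interval b n)) (sym (ℕ.+-identityʳ a))
  filter-interval-skip a (suc m) {n} ¬P = begin
    filter P? (a ∷ interval (suc a) (m + n))  ≡⟨ filter-reject P? (¬P a ℕ.≤-refl (ℕ.m<m+n a z<s)) ⟩
    filter P? (interval (suc a) (m + n))      ≡⟨ filter-interval-skip (suc a) m ¬P′ ⟩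
    filter P? (interval (suc a + m) n)        ≡⟨ cong (λ b → filter P? (interval b n)) (ℕ.+-suc a m) ⟨
    filter P? (interval (a + suc m) n)        ∎
    where
    open ≡-Reasoning
    ¬P′ : ∀ d → suc a ≤ d → d < suc a + m → ¬ P d
    ¬P′ d a<d d<1+a+m = ¬P d (ℕ.<⇒≤ a<d) (subst (d <_) (sym (ℕ.+-suc a m)) d<1+a+m)

  length-filter-interval-pairs : ∀ a j {n} → (∀ i → i < j → P (a + 2 * i) × ¬ P (suc (a + 2 * i))) →
    length (filter P? (interval a (2 * j + n))) ≡ j + length (filter P? (interval (a + 2 * j) n))
  length-filter-interval-pairs a zero    {n} _ =
    cong (λ b → length (filter P? (interval b n))) (sym (ℕ.+-identityʳ a))
  length-filter-interval-pairs a (suc j) {n} pairs = begin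
    length (filter P? (interval a (2 * suc j + n)))
      ≡⟨ cong (λ k → length (filter P? (interval a k))) (two-more j n) ⟩
    length (filter P? (a ∷ suc a ∷ interval (2 + a) (2 * j + n)))
      ≡⟨ cong length (trans (filter-accept P? Pa) (cong (a ∷_) (filter-reject P? ¬P[1+a]))) ⟩
    suc (length (filter P? (interval (2 + a) (2 * j + n))))
      ≡⟨ cong suc (length-filter-interval-pairs (2 + a) j pairs′) ⟩
    suc (j + length (filter P? (interval (2 + a + 2 * j) n)))
      ≡⟨ cong (λ b → suc (j + length (filter P? (interval b n)))) (shift a j) ⟩
    suc j + length (filter P? (interval (a + 2 * suc j) n))
      ∎
    where
    open ≡-Reasoning
    two-more : ∀ j n → 2 * suc j + n ≡ 2 + (2 * j + n)
    two-more = ℕ-solve-∀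
    shift : ∀ a i → 2 + a + 2 * i ≡ a + 2 * suc i
    shift = ℕ-solve-∀
    Pa : P a
    Pa = subst P (ℕ.+-identityʳ a) (proj₁ (pairs 0 z<s))
    ¬P[1+a] : ¬ P (suc a)
    ¬P[1+a] = subst (λ d → ¬ P (suc d)) (ℕ.+-identityʳ a) (proj₂ (pairs 0 z<s))
    pairs′ : ∀ i → i < j → P (2 + a + 2 * i) × ¬ P (suc (2 + a + 2 * i))
    pairs′ i i<j = subst (λ d → P d × ¬ P (suc d)) (sym (shift a i)) (pairs (suc i) (s≤s i<j))

divisors[2*p] : ∀ {p} → Prime p → 3 ≤ p →
                filter (_∣? 2 * p) (interval 1 (2 * p)) ≡ 1 ∷ 2 ∷ p ∷ 2 * p ∷ []
divisors[2*p] {p} p-prime 3≤p with ℕ.m≤n⇒∃[o]m+o≡n 3≤p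
... | s , refl = begin
  filter D? (interval 1 (2 * p))
    ≡⟨ cong (filter D? ∘ interval 1) (layout s) ⟩
  filter D? (1 ∷ 2 ∷ interval 3 (s + (1 + (2 + s + 1))))
    ≡⟨ trans (filter-accept D? (ℕ∣.1∣ _)) (cong (1 ∷_) (filter-accept D? (ℕ∣.m∣m*n p))) ⟩
  1 ∷ 2 ∷ filter D? (interval 3 (s + (1 + (2 + s + 1))))
    ≡⟨ cong (λ ds → 1 ∷ 2 ∷ ds) (filter-interval-skip D? 3 s below-p) ⟩
  1 ∷ 2 ∷ filter D? (p ∷ interval (suc p) (2 + s + 1))
    ≡⟨ cong (λ ds → 1 ∷ 2 ∷ ds) (filter-accept D? (ℕ∣.n∣m*n 2)) ⟩
  1 ∷ 2 ∷ p ∷ filter D? (interval (suc p) (2 + s + 1))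
    ≡⟨ cong (λ ds → 1 ∷ 2 ∷ p ∷ ds) (filter-interval-skip D? (suc p) (2 + s) between-p-2p) ⟩
  1 ∷ 2 ∷ p ∷ filter D? (interval (suc p + (2 + s)) 1)
    ≡⟨ cong (λ b → 1 ∷ 2 ∷ p ∷ filter D? (interval b 1)) (end s) ⟩
  1 ∷ 2 ∷ p ∷ filter D? (2 * p ∷ [])
    ≡⟨ cong (λ ds → 1 ∷ 2 ∷ p ∷ ds) (filter-accept D? ℕ∣.∣-refl) ⟩
  1 ∷ 2 ∷ p ∷ 2 * p ∷ []
    ∎
  where
  open ≡-Reasoning
  D? = _∣? 2 * p
  layout : ∀ s → 2 * (3 + s) ≡ 2 + (s + (1 + (2 + s + 1)))
  layout = ℕ-solve-∀
  end : ∀ s → suc (3 + s) + (2 + s) ≡ 2 * (3 + s)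
  end = ℕ-solve-∀
  no-other-divisor : ∀ {d} → 2 < d → d ≢ p → d ≢ 2 * p → ¬ d ∣ 2 * p
  no-other-divisor 2<d d≢p d≢2p d∣2p with ∣2*p⇒ p-prime d∣2p
  ... | inj₁ refl               = ℕ.<-asym 2<d (s≤s (s≤s z≤n))
  ... | inj₂ (inj₁ refl)        = ℕ.<-irrefl refl 2<d
  ... | inj₂ (inj₂ (inj₁ d≡p))  = d≢p d≡p
  ... | inj₂ (inj₂ (inj₂ d≡2p)) = d≢2p d≡2p
  below-p : ∀ d → 3 ≤ d → d < 3 + s → ¬ d ∣ 2 * p
  below-p d 3≤d d<p = no-other-divisor 3≤d (ℕ.<⇒≢ d<p) (ℕ.<⇒≢ (ℕ.<-≤-trans d<p (ℕ.m≤n*m p 2)))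
  between-p-2p : ∀ d → suc p ≤ d → d < suc p + (2 + s) → ¬ d ∣ 2 * p
  between-p-2p d p<d d<2p =
    no-other-divisor (ℕ.<-trans (ℕ.<-≤-trans (s≤s (s≤s (s≤s z≤n))) 3≤p) p<d) (ℕ.>⇒≢ p<d)
                     (ℕ.<⇒≢ (subst (d <_) (end s) d<2p))

σ[2*p] : ∀ {p} → Prime p → 3 ≤ p → ∀ k → σ k (2 * p) ≡ 1 ^ k + (2 ^ k + (p ^ k + ((2 * p) ^ k + 0)))
σ[2*p] {p} p-prime 3≤p k = cong (sum ∘ map (_^ k))
  (trans (cong (filter (_∣? 2 * p)) (range1≡interval (2 * p))) (divisors[2*p] p-prime 3≤p))

-- [1, 2r] and [p + 2, 2p - 1] split into pairs (odd, even) whose odd member alone is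
-- coprime to 2p; the pair p, p + 1 in between contributes nothing.
φ[2*p] : ∀ {p r} → Prime p → p ≡ 1 + 2 * r → φ (2 * p) ≡ 2 * r
φ[2*p] {p} {r} p-prime refl = begin
  length (filter Q? (range1 (2 * p)))
    ≡⟨ cong (length ∘ filter Q?) (range1≡interval (2 * p)) ⟩
  length (filter Q? (interval 1 (2 * p)))
    ≡⟨ cong (length ∘ filter Q? ∘ interval 1) (layout r) ⟩
  length (filter Q? (interval 1 (2 * r + (2 + 2 * r))))
    ≡⟨ length-filter-interval-pairs Q? 1 r below-p ⟩
  r + length (filter Q? (p ∷ suc p ∷ interval (2 + p) (2 * r)))
    ≡⟨ cong (λ ms → r + length ms) (trans (filter-reject Q? {x = p} (multiple ℕ∣.∣-refl))
                                          (filter-reject Q? {x = suc p} (even (2∣2+2*n r)))) ⟩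
  r + length (filter Q? (interval (2 + p) (2 * r)))
    ≡⟨ cong (λ n → r + length (filter Q? (interval (2 + p) n))) (ℕ.+-identityʳ (2 * r)) ⟨
  r + length (filter Q? (interval (2 + p) (2 * r + 0)))
    ≡⟨ cong (λ n → r + n) (length-filter-interval-pairs Q? (2 + p) r above-p) ⟩
  2 * r
    ∎
  where
  open ≡-Reasoning
  Q? = λ m → gcd m (2 * p) ℕ.≟ 1
  layout : ∀ r → 2 * (1 + 2 * r) ≡ 2 * r + (2 + 2 * r)
  layout = ℕ-solve-∀
  coprime : ∀ {m} → ¬ 2 ∣ m → ¬ p ∣ m → gcd m (2 * p) ≡ 1
  coprime 2∤m p∤m = coprime⇒gcd≡1 (from (Coprime[n,2*p]⇔ p-prime) (2∤m , p∤m))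
  even : ∀ {m} → 2 ∣ m → gcd m (2 * p) ≢ 1
  even 2∣m gcd≡1 = proj₁ (to (Coprime[n,2*p]⇔ p-prime) (gcd≡1⇒coprime gcd≡1)) 2∣m
  multiple : ∀ {m} → p ∣ m → gcd m (2 * p) ≢ 1
  multiple p∣m gcd≡1 = proj₂ (to (Coprime[n,2*p]⇔ p-prime) (gcd≡1⇒coprime gcd≡1)) p∣m
  2∣2+2*n : ∀ n → 2 ∣ 2 + 2 * n
  2∣2+2*n n = divides (1 + n) (double n)
    where double : ∀ n → 2 + 2 * n ≡ (1 + n) * 2
          double = ℕ-solve-∀
  below-p : ∀ i → i < r → gcd (1 + 2 * i) (2 * p) ≡ 1 × gcd (suc (1 + 2 * i)) (2 * p) ≢ 1
  below-p i i<r = coprime (2∤1+2*n i) (ℕ∣.>⇒∤ (s≤s (ℕ.*-monoʳ-< 2 i<r))) , even (2∣2+2*n i)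
  above-p : ∀ i → i < r → gcd (2 + p + 2 * i) (2 * p) ≡ 1 × gcd (suc (2 + p + 2 * i)) (2 * p) ≢ 1
  above-p i i<r =
    coprime (subst (¬_ ∘ (2 ∣_)) (odd r i) (2∤1+2*n (1 + r + i)))
            (∤-between (s≤s (ℕ.m≤n⇒m≤1+n (ℕ.m≤m+n p (2 * i))))
                       (subst₂ _≤_ (lhs r i) (rhs r) (ℕ.+-monoʳ-≤ (2 + 2 * r) (ℕ.*-monoʳ-≤ 2 i<r)))) ,
    even (subst (2 ∣_) (next r i) (2∣2+2*n (1 + r + i)))
    where
    odd : ∀ r i → 1 + 2 * (1 + r + i) ≡ 2 + (1 + 2 * r) + 2 * i
    odd = ℕ-solve-∀
    next : ∀ r i → 2 + 2 * (1 + r + i) ≡ suc (2 + (1 + 2 * r) + 2 * i)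
    next = ℕ-solve-∀
    lhs : ∀ r i → 2 + 2 * r + 2 * suc i ≡ suc (2 + (1 + 2 * r) + 2 * i)
    lhs = ℕ-solve-∀
    rhs : ∀ r → 2 + 2 * r + 2 * r ≡ 2 * (1 + 2 * r)
    rhs = ℕ-solve-∀

-- Membership of 2p and of 14 in S_k

module _ {p r : ℕ} (p-prime : Prime p) (p≡1+2r : p ≡ 1 + 2 * r) where

  open PowersOfTwo r

  p*σ≈2+2^[1+k] : ∀ k → + (p * σ k (2 * p)) ≈ + 2 ℤ.+ + (2 ^ suc k)
  p*σ≈2+2^[1+k] k = begin
    + (p * σ k (2 * p))
      ≡⟨ cong (λ s → + (p * s)) (σ[2*p] p-prime (odd-prime⇒3≤ {r = r} p-prime p≡1+2r) k) ⟩
    + (p * (1 ^ k + (2 ^ k + (p ^ k + ((2 * p) ^ k + 0)))))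
      ≈⟨ pos-*-cong p≈1 (pos-+-cong (≈-refl {+ (1 ^ k)}) (pos-+-cong (≈-refl {+ (2 ^ k)})
           (pos-+-cong (^-cong k p≈1) (pos-+-cong (^-cong k 2p≈2) (≈-refl {+ 0}))))) ⟩
    + (1 * (1 ^ k + (2 ^ k + (1 ^ k + (2 ^ k + 0)))))
      ≡⟨ cong (λ o → + (1 * (o + (2 ^ k + (o + (2 ^ k + 0)))))) (ℕ.^-zeroˡ k) ⟩
    + (1 * (1 + (2 ^ k + (1 + (2 ^ k + 0)))))
      ≡⟨ cong +_ (collect (2 ^ k)) ⟩
    + (2 + 2 ^ suc k)
      ≡⟨ ℤ.pos-+ 2 (2 ^ suc k) ⟩
    + 2 ℤ.+ + (2 ^ suc k)
      ∎
    where
    open SetoidReasoning ≈-setoid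
    p≈1 : + p ≈ + 1
    p≈1 = subst (λ n → + n ≈ + 1) (sym p≡1+2r) (a+k*m≈a 1 2)
    2p≈2 : + (2 * p) ≈ + 2
    2p≈2 = pos-*-cong (≈-refl {+ 2}) p≈1
    collect : ∀ x → 1 * (1 + (x + (1 + (x + 0)))) ≡ 2 + 2 * x
    collect = ℕ-solve-∀

  2p∈S⇔MinusOne : ∀ k → S k (2 * p) ⇔ MinusOne (suc k)
  2p∈S⇔MinusOne k = mk⇔ (λ (_ , congruent) → to p*σ≈1⇔ (to S-condition⇔ congruent))
                        (λ minus → composite[2*p] p-prime , from S-condition⇔ (from p*σ≈1⇔ minus))
    where
    S-condition⇔ : (+ (2 * p * σ k (2 * p)) ≡ℤ + 2 [mod φ (2 * p) ]) ⇔ + (p * σ k (2 * p)) ≈ + 1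
    S-condition⇔ = ≡ℤ⇔≈ ⇔-∘ (mod-*-cancelˡ⇔ 2 {r} {+ (p * σ k (2 * p))} {+ 1} ⇔-∘
                   mk⇔ (subst₂ congruent 2p*σ≡ φ≡) (subst₂ congruent (sym 2p*σ≡) (sym φ≡)))
      where
      congruent : ℤ → ℕ → Set
      congruent a n = a ≡ℤ + 2 [mod n ]
      2p*σ≡ : + (2 * p * σ k (2 * p)) ≡ + 2 ℤ.* + (p * σ k (2 * p))
      2p*σ≡ = trans (cong +_ (ℕ.*-assoc 2 p (σ k (2 * p)))) (ℤ.pos-* 2 (p * σ k (2 * p)))
      φ≡ : φ (2 * p) ≡ 2 * r
      φ≡ = φ[2*p] {r = r} p-prime p≡1+2r
    p*σ≈1⇔ : + (p * σ k (2 * p)) ≈ + 1 ⇔ MinusOne (suc k)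
    p*σ≈1⇔ = mk⇔ (λ p*σ≈1 → +-cancelˡ (+ 2) (≈-trans (≈-sym (p*σ≈2+2^[1+k] k)) p*σ≈1))
                 (λ minus → ≈-trans (p*σ≈2+2^[1+k] k) (+-cong (≈-refl {+ 2}) minus))

prime[7] : Prime 7
prime[7] = toWitness {a? = prime? 7} _

MinusOne[3]⇔odd : ∀ t → PowersOfTwo.MinusOne 3 t ⇔ t % 2 ≡ 1
MinusOne[3]⇔odd t = mk⇔ (MinusOne-parity ℕ.≤-refl least t)
  (λ odd → subst MinusOne (sym (t≡1+[t/2]*2 odd)) (MinusOne-periodic 1 minus-1 (t / 2)))
  where
  open PowersOfTwo 3
  minus-1 : MinusOne 1
  minus-1 = ∣⇒≈ (ℤ∣.divides (+ 1) refl)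
  least : LeastPositive MinusOne 1
  least = z<s , minus-1 , λ t 0<t t<1 _ → ℕ.<⇒≱ 0<t (ℕ.≤-pred t<1)
  t≡1+[t/2]*2 : t % 2 ≡ 1 → t ≡ 1 + t / 2 * 2
  t≡1+[t/2]*2 odd = trans (ℕ.m≡m%n+[m/n]*n t 2) (cong (_+ t / 2 * 2) odd)

14∈S⇔even : ∀ k → S k 14 ⇔ k % 2 ≡ 0
14∈S⇔even k =
  suc[n]%2≡1⇔n%2≡0 k ⇔-∘ (MinusOne[3]⇔odd (suc k) ⇔-∘ 2p∈S⇔MinusOne {r = 3} prime[7] refl k)

CaseA CaseB CaseC : ℕ → Set
CaseA r = ¬ MinusOneIn⟨2⟩ r
CaseB r = MinusOneIn⟨2⟩ r × Σ ℕ (λ t0 → LeastPosMinusOneExp r t0 × t0 % 2 ≡ 1)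
CaseC r = MinusOneIn⟨2⟩ r × Σ ℕ (λ t0 → LeastPosMinusOneExp r t0 × t0 % 2 ≡ 0)

module _ {r : ℕ} (3≤r : 3 ≤ r) where

  open PowersOfTwo r

  CaseB-CaseC-exclusive : CaseB r → ¬ CaseC r
  CaseB-CaseC-exclusive (_ , t₁ , least₁ , odd) (_ , t₀ , least₀ , even) =
    ℕ.0≢1+n (trans (sym even) (trans (cong (_% 2) (LeastPositive-unique least₀ least₁)) odd))

  case-of-least : ∀ {t₀} → LeastPositive MinusOne t₀ →
                  ¬ CaseA r × CaseB r × ¬ CaseC r ⊎ ¬ CaseA r × ¬ CaseB r × CaseC r
  case-of-least {t₀} least@(_ , minus-t₀ , _) with n%2≡0⊎n%2≡1 t₀
  ... | inj₁ even = inj₂ (¬caseA , (λ caseB → CaseB-CaseC-exclusive caseB caseC) , caseC)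
    where caseC = (t₀ , from ≡ℤ⇔≈ minus-t₀) , t₀ , from LeastPosMinusOneExp⇔ least , even
          ¬caseA = λ caseA → caseA (proj₁ caseC)
  ... | inj₂ odd  = inj₁ (¬caseA , caseB , CaseB-CaseC-exclusive caseB)
    where caseB = (t₀ , from ≡ℤ⇔≈ minus-t₀) , t₀ , from LeastPosMinusOneExp⇔ least , odd
          ¬caseA = λ caseA → caseA (proj₁ caseB)

  exactly-one-case : ¬ 2 ∣ r →
    CaseA r × ¬ CaseB r × ¬ CaseC r ⊎ ¬ CaseA r × CaseB r × ¬ CaseC r ⊎ ¬ CaseA r × ¬ CaseB r × CaseC r
  exactly-one-case r-odd =
    [ inj₂ ∘ case-of-least ∘ proj₂ , inj₁ ∘ never-case ]′ (MinusOne-dec 3≤r r-odd)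
    where
    never-case : (∀ t → ¬ MinusOne t) → CaseA r × ¬ CaseB r × ¬ CaseC r
    never-case never = caseA , caseA ∘ proj₁ , caseA ∘ proj₁
      where caseA : CaseA r
            caseA (t , minus-t) = never t (to ≡ℤ⇔≈ minus-t)

  CaseC⇔4∣order : Prime r → CaseC r ⇔ Σ ℕ (λ o → IsOrd2 r o × 4 ∣ o)
  CaseC⇔4∣order r-prime = mk⇔
    (λ (_ , t₀ , least , even) → order (to least-even⇔order-4∣′ (t₀ , to LeastPosMinusOneExp⇔ least , even)))
    (λ (o , ord , 4∣o) → caseC (from least-even⇔order-4∣′ (o , to IsOrd2⇔ ord , 4∣o)))
    where
    least-even⇔order-4∣′ = least-even⇔order-4∣ 3≤r r-prime
    order : (∃ λ o → LeastPositive One o × 4 ∣ o) → Σ ℕ (λ o → IsOrd2 r o × 4 ∣ o)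
    order (o , ord , 4∣o) = o , from IsOrd2⇔ ord , 4∣o
    caseC : (∃ λ t₀ → LeastPositive MinusOne t₀ × t₀ % 2 ≡ 0) → CaseC r
    caseC (t₀ , least@(_ , minus-t₀ , _) , even) =
      (t₀ , from ≡ℤ⇔≈ minus-t₀) , t₀ , from LeastPosMinusOneExp⇔ least , even

module _ {p r : ℕ} (p-prime : Prime p) (p≡1+2r : p ≡ 1 + 2 * r) where

  open PowersOfTwo r

  CaseA⇒never-in-S : CaseA r → ∀ k → ¬ S k (2 * p)
  CaseA⇒never-in-S caseA k 2p∈S = caseA (suc k , from ≡ℤ⇔≈ (to (2p∈S⇔MinusOne p-prime p≡1+2r k) 2p∈S))

  infinitely-often-in-S : ∀ {t₀} → LeastPositive MinusOne t₀ → InfinitelyManyS (2 * p)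
  infinitely-often-in-S {suc t₀} (_ , minus-t₀ , _) N =
    t₀ + N * (2 * suc t₀) ,
    ℕ.≤-trans (ℕ.m≤m*n N (2 * suc t₀)) (ℕ.m≤n+m _ t₀) ,
    from (2p∈S⇔MinusOne p-prime p≡1+2r (t₀ + N * (2 * suc t₀))) (MinusOne-periodic (suc t₀) minus-t₀ N)

  module _ (3≤r : 3 ≤ r) where

    parity-of-S : ∀ {t₀} → LeastPositive MinusOne t₀ → ∀ k → S k (2 * p) → suc k % 2 ≡ t₀ % 2
    parity-of-S least k 2p∈S =
      MinusOne-parity 3≤r least (suc k) (to (2p∈S⇔MinusOne p-prime p≡1+2r k) 2p∈S)

    CaseB⇒never-flanked : CaseB r → InfinitelyManyS (2 * p) × (∀ k → ¬ Flanks14 (2 * p) k)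
    CaseB⇒never-flanked (_ , _ , least , odd) = infinitely-often-in-S least′ , not-flanked
      where
      least′ = to LeastPosMinusOneExp⇔ least
      not-flanked : ∀ k → ¬ Flanks14 (2 * p) k
      not-flanked k (_ , 2p∈S , _ , 14∈S) =
        ℕ.0≢1+n (trans (sym (to (14∈S⇔even (suc k)) 14∈S)) (trans (parity-of-S least′ k 2p∈S) odd))

    CaseC⇒always-flanked : CaseC r → InfinitelyManyS (2 * p) × (∀ k → S k (2 * p) → Flanks14 (2 * p) k)
    CaseC⇒always-flanked (_ , _ , least , even) = infinitely-often-in-S least′ , flanked
      where
      least′ = to LeastPosMinusOneExp⇔ least
      flanked : ∀ k → S k (2 * p) → Flanks14 (2 * p) k
      flanked zero    2p∈S = ⊥-elim (ℕ.1+n≢0 (trans (parity-of-S least′ 0 2p∈S) even))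
      flanked (suc k) 2p∈S =
        s≤s z≤n , 2p∈S , from (14∈S⇔even k) k-even , from (14∈S⇔even (suc (suc k))) k-even
        where k-even = trans (parity-of-S least′ (suc k) 2p∈S) even

half-of-3-mod-4 : ∀ {p} → p % 4 ≡ 3 → 5 ≤ p →
  let r = (p ∸ 1) / 2 in p ≡ 1 + 2 * r × 3 ≤ r × ¬ 2 ∣ r
half-of-3-mod-4 {p} p%4≡3 5≤p =
  subst (λ r → p ≡ 1 + 2 * r × 3 ≤ r × ¬ 2 ∣ r) (sym r≡1+2q)
    (trans p≡3+q*4 (regroup q) , s≤s (ℕ.*-monoʳ-≤ 2 1≤q) , 2∤1+2*n q)
  where
  q = p / 4
  p≡3+q*4 : p ≡ 3 + q * 4
  p≡3+q*4 = trans (ℕ.m≡m%n+[m/n]*n p 4) (cong (_+ q * 4) p%4≡3)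
  regroup : ∀ q → 3 + q * 4 ≡ 1 + 2 * (1 + 2 * q)
  regroup = ℕ-solve-∀
  halve : ∀ q → 2 + q * 4 ≡ (1 + 2 * q) * 2
  halve = ℕ-solve-∀
  r≡1+2q : (p ∸ 1) / 2 ≡ 1 + 2 * q
  r≡1+2q = trans (cong (λ n → (n ∸ 1) / 2) p≡3+q*4)
                 (trans (cong (_/ 2) (halve q)) (ℕ.m*n/n≡m (1 + 2 * q) 2))
  1≤q : 1 ≤ q
  1≤q = ℕ.n≢0⇒n>0 λ q≡0 →
    ℕ.<⇒≱ 5≤p (ℕ.m≤n⇒m≤1+n (ℕ.≤-reflexive (trans p≡3+q*4 (cong (λ x → 3 + x * 4) q≡0))))

theorem4p5 : (p : ℕ) → Prime p → 5 ≤ p → p % 4 ≡ 3 →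
  let r = (p ∸ 1) / 2
      condA = ¬ MinusOneIn⟨2⟩ r
      condB = MinusOneIn⟨2⟩ r × Σ ℕ (λ t0 → LeastPosMinusOneExp r t0 × t0 % 2 ≡ 1)
      condC = MinusOneIn⟨2⟩ r × Σ ℕ (λ t0 → LeastPosMinusOneExp r t0 × t0 % 2 ≡ 0)
  in
  -- exactly one of the three cases holds
  (condA × ¬ condB × ¬ condC ⊎ ¬ condA × condB × ¬ condC ⊎ ¬ condA × ¬ condB × condC)
  -- (A)
  × (condA → ∀ k → ¬ S k (2 * p))
  -- (B)
  × (condB → InfinitelyManyS (2 * p) × (∀ k → ¬ Flanks14 (2 * p) k))
  -- (C)
  × (condC → InfinitelyManyS (2 * p) × (∀ k → S k (2 * p) → Flanks14 (2 * p) k))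
  -- when r is prime: (C) iff 4 ∣ ord_r(2)
  × (Prime r → (condC ⇔ Σ ℕ (λ o → IsOrd2 r o × 4 ∣ o)))
theorem4p5 p p-prime 5≤p p%4≡3 with half-of-3-mod-4 p%4≡3 5≤p
... | p≡1+2r , 3≤r , r-odd =
  exactly-one-case 3≤r r-odd ,
  CaseA⇒never-in-S p-prime p≡1+2r ,
  CaseB⇒never-flanked p-prime p≡1+2r 3≤r ,
  CaseC⇒always-flanked p-prime p≡1+2r 3≤r ,
  CaseC⇔4∣order 3≤r
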